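{- Let $A$ be an MV-monoidal algebra and set $\sigma_1(x,y,z)=(x\oplus y)\odot((x\odot y)\oplus z)$, $\sigma_2(x,y,z)=(x\odot y)\oplus((x\oplus y)\odot z)$, $\sigma_3(x,y,z)=(x\odot(y\oplus z))\oplus(y\odot z)$, $\sigma_4(x,y,z)=(x\oplus(y\odot z))\odot(y\oplus z)$. Then for all $i,j\in\{1,2,3,4\}$, every permutation $\rho$ of $\{1,2,3\}$ and all $x_1,x_2,x_3\in A$, we have $\sigma_i(x_1,x_2,x_3)=\sigma_j(x_{\rho(1)},x_{\rho(2)},x_{\rho(3)})$.
   Context: An MV-monoidal algebra is an algebra $\langle A;\oplus,\odot,\vee,\wedge,0,1\rangle$ (arities $2,2,2,2,0,0$) satisfying: $\langle A;\vee,\wedge\rangle$ is a distributive lattice; $\langle A;\oplus,0\rangle$ and $\langle A;\odot,1\rangle$ are commutative monoids; $\oplus$ and $\odot$ both distribute over both $\vee$ and $\wedge$; $(x\oplus y)\odot((x\odot y)\oplus z)=(x\odot(y\oplus z))\oplus(y\odot z)$; $(x\odot y)\oplus((x\oplus y)\odot z)=(x\oplus(y\odot z))\odot(y\oplus z)$; $(x\odot y)\oplus z=((x\oplus y)\odot((x\odot y)\oplus z))\vee z$; $(x\oplus y)\odot z=((x\odot y)\oplus((x\oplus y)\odot z))\wedge z$. -}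

module Defs where

open import Level using (Level) renaming (suc to lsuc)
open import Relation.Binary.PropositionalEquality using (_≡_)
open import Algebra.Core using (Op₂)
open import Data.Fin using (Fin; zero; suc)

module _ {a : Level} {A : Set a} where
  open import Algebra.Definitions (_≡_ {A = A}) using (_DistributesOver_)
  open import Algebra.Structures (_≡_ {A = A}) using (IsCommutativeMonoid)
  open import Algebra.Lattice.Structures (_≡_ {A = A}) using (IsDistributiveLattice)

  record IsMVMonoidal (_⊕_ _⊙_ _∨_ _∧_ : Op₂ A) (𝟘 𝟙 : A) : Set a where
    field
      isDistributiveLattice : IsDistributiveLattice _∨_ _∧_
      ⊕-isCommutativeMonoid : IsCommutativeMonoid _⊕_ 𝟘
      ⊙-isCommutativeMonoid : IsCommutativeMonoid _⊙_ 𝟙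
      ⊕-distrib-∨ : _⊕_ DistributesOver _∨_
      ⊕-distrib-∧ : _⊕_ DistributesOver _∧_
      ⊙-distrib-∨ : _⊙_ DistributesOver _∨_
      ⊙-distrib-∧ : _⊙_ DistributesOver _∧_
      ax1 : ∀ x y z → ((x ⊕ y) ⊙ ((x ⊙ y) ⊕ z)) ≡ ((x ⊙ (y ⊕ z)) ⊕ (y ⊙ z))
      ax2 : ∀ x y z → ((x ⊙ y) ⊕ ((x ⊕ y) ⊙ z)) ≡ ((x ⊕ (y ⊙ z)) ⊙ (y ⊕ z))
      ax3 : ∀ x y z → ((x ⊙ y) ⊕ z) ≡ (((x ⊕ y) ⊙ ((x ⊙ y) ⊕ z)) ∨ z)
      ax4 : ∀ x y z → ((x ⊕ y) ⊙ z) ≡ (((x ⊙ y) ⊕ ((x ⊕ y) ⊙ z)) ∧ z)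

record MVMonoidal (a : Level) : Set (lsuc a) where
  field
    Carrier : Set a
    _⊕_ _⊙_ _∨_ _∧_ : Op₂ Carrier
    𝟘 𝟙 : Carrier
    isMVMonoidal : IsMVMonoidal _⊕_ _⊙_ _∨_ _∧_ 𝟘 𝟙

  σ₁ σ₂ σ₃ σ₄ : Carrier → Carrier → Carrier → Carrier
  σ₁ x y z = (x ⊕ y) ⊙ ((x ⊙ y) ⊕ z)
  σ₂ x y z = (x ⊙ y) ⊕ ((x ⊕ y) ⊙ z)
  σ₃ x y z = (x ⊙ (y ⊕ z)) ⊕ (y ⊙ z)
  σ₄ x y z = (x ⊕ (y ⊙ z)) ⊙ (y ⊕ z)

  σ : Fin 4 → Carrier → Carrier → Carrier → Carrier
  σ zero = σ₁
  σ (suc zero) = σ₂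
  σ (suc (suc zero)) = σ₃
  σ (suc (suc (suc zero))) = σ₄

-- Both ⊕ and ⊙ are commutative, so σ₁ is symmetric in its first two arguments
-- and σ₃ in its last two; the axiom σ₁ = σ₃ therefore makes σ₁ symmetric in all
-- three. Up to commutativity σ₃ x y z is σ₂ y z x, so the same axiom identifies
-- σ₂ with a permuted σ₁, and the second axiom σ₂ = σ₄ finishes the job: all four
-- σᵢ are one and the same fully symmetric ternary term.
module Submission where

open import Defs
open import Level using (Level)
open import Relation.Binary.PropositionalEquality
  using (_≡_; _≢_; refl; sym; trans; cong; cong₂; module ≡-Reasoning)
open import Data.Fin using (Fin; zero; suc)
open import Data.Fin.Patterns using (0F; 1F; 2F; 3F)
open import Data.Fin.Permutation using (Permutation′; _⟨$⟩ʳ_)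
open import Function.Bundles using (Injection)
open import Function.Properties.Inverse using (↔⇒↣)
open import Data.Empty using (⊥-elim)
open import Algebra.Structures using (IsCommutativeMonoid)

module Symmetric₃ {c : Level} {C : Set c} (f : C → C → C → C)
  (swap₁₂ : ∀ x y z → f x y z ≡ f y x z)
  (swap₂₃ : ∀ x y z → f x y z ≡ f x z y) where

  reindex-distinct : (x : Fin 3 → C) (p q r : Fin 3) → p ≢ q → p ≢ r → q ≢ r →
    f (x 0F) (x 1F) (x 2F) ≡ f (x p) (x q) (x r)
  reindex-distinct x 0F 1F 2F _ _ _ = refl
  reindex-distinct x 0F 2F 1F _ _ _ = swap₂₃ _ _ _
  reindex-distinct x 1F 0F 2F _ _ _ = swap₁₂ _ _ _
  reindex-distinct x 1F 2F 0F _ _ _ = trans (swap₁₂ _ _ _) (swap₂₃ _ _ _)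
  reindex-distinct x 2F 0F 1F _ _ _ = trans (swap₂₃ _ _ _) (swap₁₂ _ _ _)
  reindex-distinct x 2F 1F 0F _ _ _ =
    trans (swap₁₂ _ _ _) (trans (swap₂₃ _ _ _) (swap₁₂ _ _ _))
  reindex-distinct x 0F 0F _  p≢q _   _   = ⊥-elim (p≢q refl)
  reindex-distinct x 1F 1F _  p≢q _   _   = ⊥-elim (p≢q refl)
  reindex-distinct x 2F 2F _  p≢q _   _   = ⊥-elim (p≢q refl)
  reindex-distinct x 0F _  0F _   p≢r _   = ⊥-elim (p≢r refl)
  reindex-distinct x 1F _  1F _   p≢r _   = ⊥-elim (p≢r refl)
  reindex-distinct x 2F _  2F _   p≢r _   = ⊥-elim (p≢r refl)
  reindex-distinct x _  0F 0F _   _   q≢r = ⊥-elim (q≢r refl)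
  reindex-distinct x _  1F 1F _   _   q≢r = ⊥-elim (q≢r refl)
  reindex-distinct x _  2F 2F _   _   q≢r = ⊥-elim (q≢r refl)

  permute : (ρ : Permutation′ 3) (x : Fin 3 → C) →
    f (x 0F) (x 1F) (x 2F) ≡ f (x (ρ ⟨$⟩ʳ 0F)) (x (ρ ⟨$⟩ʳ 1F)) (x (ρ ⟨$⟩ʳ 2F))
  permute ρ x = reindex-distinct x _ _ _ (ρ-≢ λ ()) (ρ-≢ λ ()) (ρ-≢ λ ())
    where
    ρ-≢ : {i j : Fin 3} → i ≢ j → ρ ⟨$⟩ʳ i ≢ ρ ⟨$⟩ʳ j
    ρ-≢ i≢j = λ ρi≡ρj → i≢j (Injection.injective (↔⇒↣ ρ) ρi≡ρj)

module Properties {a : Level} (A : MVMonoidal a) where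
  open MVMonoidal A
  open IsMVMonoidal isMVMonoidal
  open IsCommutativeMonoid ⊕-isCommutativeMonoid using () renaming (comm to ⊕-comm)
  open IsCommutativeMonoid ⊙-isCommutativeMonoid using () renaming (comm to ⊙-comm)
  open ≡-Reasoning

  σ₁-swap₁₂ : ∀ x y z → σ₁ x y z ≡ σ₁ y x z
  σ₁-swap₁₂ x y z = cong₂ _⊙_ (⊕-comm x y) (cong (_⊕ z) (⊙-comm x y))

  σ₃-swap₂₃ : ∀ x y z → σ₃ x y z ≡ σ₃ x z y
  σ₃-swap₂₃ x y z = cong₂ _⊕_ (cong (x ⊙_) (⊕-comm y z)) (⊙-comm y z)

  σ₁-swap₂₃ : ∀ x y z → σ₁ x y z ≡ σ₁ x z y
  σ₁-swap₂₃ x y z = begin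
    σ₁ x y z ≡⟨ ax1 x y z ⟩
    σ₃ x y z ≡⟨ σ₃-swap₂₃ x y z ⟩
    σ₃ x z y ≡⟨ ax1 x z y ⟨
    σ₁ x z y ∎

  σ₃≡σ₂-rotated : ∀ x y z → σ₃ x y z ≡ σ₂ y z x
  σ₃≡σ₂-rotated x y z = trans (⊕-comm _ _) (cong ((y ⊙ z) ⊕_) (⊙-comm x (y ⊕ z)))

  σ₂≡σ₁ : ∀ x y z → σ₂ x y z ≡ σ₁ x y z
  σ₂≡σ₁ x y z = begin
    σ₂ x y z ≡⟨ σ₃≡σ₂-rotated z x y ⟨
    σ₃ z x y ≡⟨ ax1 z x y ⟨
    σ₁ z x y ≡⟨ σ₁-swap₁₂ z x y ⟩
    σ₁ x z y ≡⟨ σ₁-swap₂₃ x z y ⟩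
    σ₁ x y z ∎

  σ≡σ₁ : ∀ i x y z → σ i x y z ≡ σ₁ x y z
  σ≡σ₁ 0F x y z = refl
  σ≡σ₁ 1F x y z = σ₂≡σ₁ x y z
  σ≡σ₁ 2F x y z = sym (ax1 x y z)
  σ≡σ₁ 3F x y z = trans (sym (ax2 x y z)) (σ₂≡σ₁ x y z)

  open Symmetric₃ σ₁ σ₁-swap₁₂ σ₁-swap₂₃ public renaming (permute to σ₁-permute)

lemma6p3 : ∀ {a : Level} (A : MVMonoidal a) → let open MVMonoidal A in
    (i j : Fin 4) (ρ : Permutation′ 3) (x : Fin 3 → Carrier) →
    σ i (x zero) (x (suc zero)) (x (suc (suc zero)))
      ≡ σ j (x (ρ ⟨$⟩ʳ zero)) (x (ρ ⟨$⟩ʳ suc zero)) (x (ρ ⟨$⟩ʳ suc (suc zero)))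
lemma6p3 A i j ρ x = begin
  σ i (x 0F) (x 1F) (x 2F)                          ≡⟨ σ≡σ₁ i _ _ _ ⟩
  σ₁ (x 0F) (x 1F) (x 2F)                           ≡⟨ σ₁-permute ρ x ⟩
  σ₁ (x (ρ ⟨$⟩ʳ 0F)) (x (ρ ⟨$⟩ʳ 1F)) (x (ρ ⟨$⟩ʳ 2F)) ≡⟨ σ≡σ₁ j _ _ _ ⟨
  σ j (x (ρ ⟨$⟩ʳ 0F)) (x (ρ ⟨$⟩ʳ 1F)) (x (ρ ⟨$⟩ʳ 2F)) ∎
  where
  open MVMonoidal A
  open Properties A
  open ≡-Reasoning
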